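{- Let $1\le h\le m$ and $\ell\ge0$ be integers. The number of compositions $(a_1,\dots,a_h)$ of $m$ into $h$ positive parts having exactly $\ell$ parts $a_i\ge3$ (equivalently, whose deletion of the first two columns has dimension $\ell$) equals $c'^{\,m}_{h\ell}$, where for $\ell\ge1$ $$c'^{\,m}_{h\ell}=\sum_{f}\frac{\ell}{m-h-f}\binom{h}{f}\binom{f}{\ell}\binom{m-h-f}{\ell}=\binom{h}{\ell}\sum_{f}\binom{h-\ell}{f-\ell}\binom{m-h-f-1}{\ell-1},$$ the sums running over integers $f$ with $\ell\le f\le\min(h,\,m-h-\ell)$, and $c'^{\,m}_{h0}=\binom{h}{m-h}$ (which is $0$ if $m>2h$).
   Context: A composition of weight $m$ and dimension $h$ is an ordered $h$-tuple of positive integers summing to $m$. Deleting the first two columns of $(a_1,\dots,a_h)$ yields $(a_i-2)_{i:\,a_i\ge3}$, whose dimension is the number of $i$ with $a_i\ge3$. Binomial coefficients $\binom{a}{b}$ are $0$ unless $0\le b\le a$. -}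

module Defs where

open import Data.Nat using (ℕ; zero; suc; _+_; _*_; _∸_; _⊓_; _≤_; _≤?_; _≟_)
open import Data.Nat.Combinatorics using (_C_)
open import Data.List using (List; []; _∷_; map; concatMap; upTo; filter; length; foldr)
open import Data.Nat.ListAction using (sum)
open import Data.List.Relation.Unary.All using (All)
open import Data.List.Relation.Unary.All using (all?)
open import Data.Vec using (Vec; []; _∷_; toList)
open import Data.Integer using (+_)
open import Data.Rational as ℚ using (ℚ; 0ℚ; _/_)
open import Relation.Nullary.Decidable using (Dec; _×-dec_)
open import Data.Product using (_×_)
open import Relation.Binary.PropositionalEquality using (_≡_)

tuples : (h m : ℕ) → List (Vec ℕ h)
tuples zero    m = [] ∷ []
tuples (suc h) m = concatMap (λ a → map (a ∷_) (tuples h m)) (upTo (suc m))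

IsComposition : (m h : ℕ) → Vec ℕ h → Set
IsComposition m h a = All (λ x → 1 ≤ x) (toList a) × (sum (toList a) ≡ m)

isComposition? : (m h : ℕ) → (a : Vec ℕ h) → Dec (IsComposition m h a)
isComposition? m h a = all? (λ x → 1 ≤? x) (toList a) ×-dec (sum (toList a) ≟ m)

bigParts : {h : ℕ} → Vec ℕ h → ℕ
bigParts a = length (filter (λ x → 3 ≤? x) (toList a))

-- The list of compositions of m into h positive parts (every part is ≤ m, so
-- this filter of the exhaustive enumeration lists each composition exactly once).
compositions : (m h : ℕ) → List (Vec ℕ h)
compositions m h = filter (isComposition? m h) (tuples h m)

countComp : (m h ℓ : ℕ) → ℕ
countComp m h ℓ = length (filter (λ a → bigParts a ≟ ℓ) (compositions m h))

sumRange : ℕ → ℕ → (ℕ → ℕ) → ℕ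
sumRange a b g = sum (map (λ i → g (a + i)) (upTo (suc b ∸ a)))

sumRangeℚ : ℕ → ℕ → (ℕ → ℚ) → ℚ
sumRangeℚ a b g = foldr ℚ._+_ 0ℚ (map (λ i → g (a + i)) (upTo (suc b ∸ a)))

ℕtoℚ : ℕ → ℚ
ℕtoℚ n = (+ n) / 1

-- n / d as a rational; the value for d = 0 is an irrelevant dummy
-- (d = m-h-f ≥ ℓ ≥ 1 throughout the summation range).
fracℚ : ℕ → ℕ → ℚ
fracℚ n zero    = 0ℚ
fracℚ n (suc d) = (+ n) / suc d

-- Upper summation bound min(h, m-h-ℓ) (when m-h-ℓ < 0 the truncated value 0 < ℓ gives an empty range for ℓ ≥ 1).
upperF : (m h ℓ : ℕ) → ℕ
upperF m h ℓ = h ⊓ (m ∸ h ∸ ℓ)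

firstForm : (m h ℓ : ℕ) → ℚ
firstForm m h ℓ = sumRangeℚ ℓ (upperF m h ℓ)
  (λ f → fracℚ ℓ (m ∸ h ∸ f) ℚ.* ℕtoℚ ((h C f) * (f C ℓ) * ((m ∸ h ∸ f) C ℓ)))

secondForm : (m h ℓ : ℕ) → ℕ
secondForm m h ℓ = (h C ℓ) * sumRange ℓ (upperF m h ℓ)
  (λ f → ((h ∸ ℓ) C (f ∸ ℓ)) * ((m ∸ h ∸ f ∸ 1) C (ℓ ∸ 1)))

c′ : (m h ℓ : ℕ) → ℕ
c′ m h zero      = h C (m ∸ h)
c′ m h (suc ℓ)   = secondForm m h (suc ℓ)

module Submission where

open import Defs
open import Data.Nat using (ℕ; _≤_)
open import Data.Product using (_×_)
open import Relation.Binary.PropositionalEquality using (_≡_)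

open import Data.Nat using (zero; suc; _+_; _*_; _∸_; _⊓_; _<_; _!; _≤?_; _<?_; _≟_; z≤n; s≤s; z<s; s<s)
open import Data.Nat.Properties
open import Algebra.Properties.CommutativeSemigroup +-commutativeSemigroup
  using () renaming (interchange to +-interchange)
open import Data.Nat.Combinatorics using (_C_; nCn≡1; k>n⇒nCk≡0; nCk+nC[k+1]≡[n+1]C[k+1]; nCk≡n!/k![n-k]!; k![n∸k]!∣n!)
open import Data.Nat.DivMod using (m/n*n≡m)
open import Data.Nat.GeneralisedArithmetic using (fold)
open import Data.Nat.ListAction using (sum)
open import Data.Nat.Tactic.RingSolver using (solve-∀)
open import Data.List using (List; []; _∷_; map; concatMap; upTo; applyUpTo; filter; length; foldr)
open import Data.List.Properties using (map-applyUpTo; filter-++; length-++; filter-≐; filter-none)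
import Data.List.Relation.Unary.All as All
open import Data.Vec using (Vec; toList; _∷_)
open import Data.Product using (_,_)
open import Data.Sum using (inj₁; inj₂)
open import Data.Empty using (⊥-elim)
import Data.Integer as ℤ
import Data.Integer.Properties as ℤ
open import Data.Rational using (ℚ; 0ℚ; fromℚᵘ) renaming (_+_ to _+ℚ_; _*_ to _*ℚ_)
open import Data.Rational.Properties using (toℚᵘ-injective; toℚᵘ-homo-+; toℚᵘ-homo-*; toℚᵘ-fromℚᵘ; fromℚᵘ-cong)
open import Data.Rational.Unnormalised using (mkℚᵘ; *≡*) renaming (_+_ to _+ᵘ_; _*_ to _*ᵘ_)
import Data.Rational.Unnormalised.Properties as ℚᵘ
open import Function using (_∘_; id)
open import Level using (0ℓ)
open import Relation.Nullary using (¬_; yes; no)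
open import Relation.Nullary.Decidable using (_×-dec_)
open import Relation.Unary using (Pred; Decidable)
open import Relation.Binary using (Setoid)
open import Relation.Binary.PropositionalEquality
  using (refl; sym; trans; cong; cong₂; subst; _≗_; _→-setoid_; module ≡-Reasoning)

-- In generating-function terms, a part contributes x + x² if it is at most 2
-- and y x³/(1 - x) otherwise, so the compositions of length h are
-- counted by (x + x² + y x³/(1 - x))^h.  Expanding in y, the coefficient of
-- y^ℓ is C(h,ℓ) xⁿ(1 + x)ⁿ x³ˡ/(1 - x)ˡ with n = h - ℓ, and reading off the
-- coefficient of x^m with both binomial series gives the second formula for
-- c′.  The first formula agrees with it term by term, by the identities
-- C(h,f) C(f,ℓ) = C(h,ℓ) C(h-ℓ,f-ℓ) and ℓ C(d,ℓ) = d C(d-1,ℓ-1).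
-- Power series are coefficient sequences ℕ → ℕ; multiplication by x, by
-- 1/(1 - x) and by another series is shift, partialSums and conv.

∑< : ℕ → (ℕ → ℕ) → ℕ
∑< n F = sum (applyUpTo F n)

syntax ∑< n (λ i → F) = ∑[ i < n ] F

sum-map-upTo : ∀ (F : ℕ → ℕ) n → sum (map F (upTo n)) ≡ ∑< n F
sum-map-upTo F n = cong sum (map-applyUpTo id F n)

∑<-cong : ∀ n {F G : ℕ → ℕ} → (∀ i → i < n → F i ≡ G i) → ∑< n F ≡ ∑< n G
∑<-cong zero    eq = refl
∑<-cong (suc n) eq = cong₂ _+_ (eq 0 z<s) (∑<-cong n (λ i i<n → eq (suc i) (s<s i<n)))

∑<-+ : ∀ n (F G : ℕ → ℕ) → ∑[ i < n ] (F i + G i) ≡ ∑< n F + ∑< n G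
∑<-+ zero    F G = refl
∑<-+ (suc n) F G = trans (cong (F 0 + G 0 +_) (∑<-+ n (F ∘ suc) (G ∘ suc)))
                         (+-interchange (F 0) (G 0) _ _)

∑<-*ˡ : ∀ n c (F : ℕ → ℕ) → ∑[ i < n ] (c * F i) ≡ c * ∑< n F
∑<-*ˡ zero    c F = sym (*-zeroʳ c)
∑<-*ˡ (suc n) c F = trans (cong (c * F 0 +_) (∑<-*ˡ n c (F ∘ suc)))
                          (sym (*-distribˡ-+ c (F 0) _))

∑<-truncate : ∀ {c} a {F : ℕ → ℕ} → c ≤ a → (∀ i → c ≤ i → i < a → F i ≡ 0) →
  ∑< a F ≡ ∑< c F
∑<-truncate {zero}  zero    _         _      = refl
∑<-truncate {zero}  (suc a) _         vanish =
  cong₂ _+_ (vanish 0 z≤n z<s) (∑<-truncate a z≤n (λ i _ i<a → vanish (suc i) z≤n (s<s i<a)))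
∑<-truncate {suc c} (suc a) {F} (s≤s c≤a) vanish =
  cong (F 0 +_) (∑<-truncate a c≤a (λ i c≤i i<a → vanish (suc i) (s≤s c≤i) (s<s i<a)))

∑<-zero : ∀ n {F : ℕ → ℕ} → (∀ i → i < n → F i ≡ 0) → ∑< n F ≡ 0
∑<-zero n vanish = ∑<-truncate n z≤n (λ i _ → vanish i)

∸-positive⇒+≤ : ∀ {m n o} → suc m ≤ o ∸ n → suc m + n ≤ o
∸-positive⇒+≤ {m} p = m≤o∸n⇒m+n≤o (suc m)
  (<⇒≤ (m∸n≢0⇒n<m λ o∸n≡0 → n≮0 (subst (suc m ≤_) o∸n≡0 p))) p

-- suc U ∸ ℓ is the number of f with ℓ ≤ f ≤ U, which are enumerated as f = ℓ + i.
<-range⇒≤ : ∀ {i} U ℓ → i < suc U ∸ ℓ → ℓ + i ≤ U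
<-range⇒≤     U       zero    i<c = ≤-pred i<c
<-range⇒≤ {i} zero    (suc ℓ) i<c = ⊥-elim (n≮0 (subst (i <_) (0∸n≡0 ℓ) i<c))
<-range⇒≤     (suc U) (suc ℓ) i<c = s≤s (<-range⇒≤ U ℓ i<c)

≥-range⇒> : ∀ {i} U ℓ → suc U ∸ ℓ ≤ i → U < ℓ + i
≥-range⇒> U ℓ c≤i = ≤-trans (m≤n+m∸n (suc U) ℓ) (+-monoʳ-≤ ℓ c≤i)

module _ {A : Set} {P : Pred A 0ℓ} (P? : Decidable P) where

  length-filter-concatMap : ∀ {B : Set} (f : B → List A) xs →
    length (filter P? (concatMap f xs)) ≡ sum (map (λ b → length (filter P? (f b))) xs)
  length-filter-concatMap f []       = refl
  length-filter-concatMap f (x ∷ xs) = begin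
      length (filter P? (f x Data.List.++ concatMap f xs))
    ≡⟨ cong length (filter-++ P? (f x) (concatMap f xs)) ⟩
      length (filter P? (f x) Data.List.++ filter P? (concatMap f xs))
    ≡⟨ length-++ (filter P? (f x)) ⟩
      length (filter P? (f x)) + length (filter P? (concatMap f xs))
    ≡⟨ cong (length (filter P? (f x)) +_) (length-filter-concatMap f xs) ⟩
      length (filter P? (f x)) + sum (map (λ b → length (filter P? (f b))) xs) ∎
    where open ≡-Reasoning

  length-filter-map : ∀ {B : Set} (f : B → A) xs →
    length (filter P? (map f xs)) ≡ length (filter (P? ∘ f) xs)
  length-filter-map f []       = refl
  length-filter-map f (x ∷ xs) with P? (f x)
  ... | yes _ = cong suc (length-filter-map f xs)
  ... | no  _ = length-filter-map f xs

  length-filter-none : (∀ x → ¬ P x) → ∀ xs → length (filter P? xs) ≡ 0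
  length-filter-none ¬P xs = cong length (filter-none P? (All.universal ¬P xs))

  filter-filter : ∀ {Q : Pred A 0ℓ} (Q? : Decidable Q) xs →
    filter Q? (filter P? xs) ≡ filter (λ x → P? x ×-dec Q? x) xs
  filter-filter Q? []       = refl
  filter-filter Q? (x ∷ xs) with P? x
  ... | no  _ = filter-filter Q? xs
  ... | yes _ with Q? x
  ...   | yes _ = cong (x ∷_) (filter-filter Q? xs)
  ...   | no  _ = filter-filter Q? xs

Series : Set
Series = ℕ → ℕ

open Setoid (ℕ →-setoid ℕ) using () renaming (sym to ≗-sym; trans to ≗-trans)

0ₛ : Series
0ₛ _ = 0

δ : Series
δ zero    = 1
δ (suc _) = 0

infixl 6 _⊕_
_⊕_ : Series → Series → Series
(X ⊕ Y) M = X M + Y M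

infixr 7 _⊙_
_⊙_ : ℕ → Series → Series
(c ⊙ X) M = c * X M

shift : Series → Series
shift X zero    = 0
shift X (suc M) = X M

partialSums : Series → Series
partialSums X zero    = X 0
partialSums X (suc M) = partialSums X M + X (suc M)

conv : Series → Series → Series
conv K Y M = ∑[ j < suc M ] (K j * Y (M ∸ j))

shiftBy : ℕ → Series → Series
shiftBy n X = fold X shift n

Congruent : (Series → Series) → Set
Congruent F = ∀ {X Y} → X ≗ Y → F X ≗ F Y

fold-cong : ∀ {F : Series → Series} → Congruent F → ∀ n → Congruent (λ X → fold X F n)
fold-cong F-cong zero    X≗Y = X≗Y
fold-cong F-cong (suc n) X≗Y = F-cong (fold-cong F-cong n X≗Y)

fold-commute : ∀ {F} (G : Series → Series) → Congruent F → (∀ X → G (F X) ≗ F (G X)) →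
  ∀ n X → G (fold X F n) ≗ fold (G X) F n
fold-commute G F-cong GF≗FG zero    X = λ _ → refl
fold-commute G F-cong GF≗FG (suc n) X =
  ≗-trans (GF≗FG (fold X _ n)) (F-cong (fold-commute G F-cong GF≗FG n X))

⊕-cong : ∀ {X X′ Y Y′} → X ≗ X′ → Y ≗ Y′ → X ⊕ Y ≗ X′ ⊕ Y′
⊕-cong p q M = cong₂ _+_ (p M) (q M)

shift-cong : Congruent shift
shift-cong p zero    = refl
shift-cong p (suc M) = p M

shift-⊕ : ∀ X Y → shift (X ⊕ Y) ≗ shift X ⊕ shift Y
shift-⊕ X Y zero    = refl
shift-⊕ X Y (suc M) = refl

shift-⊙ : ∀ c X → c ⊙ shift X ≗ shift (c ⊙ X)
shift-⊙ c X zero    = *-zeroʳ c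
shift-⊙ c X (suc M) = refl

partialSums-cong : Congruent partialSums
partialSums-cong p zero    = p 0
partialSums-cong p (suc M) = cong₂ _+_ (partialSums-cong p M) (p (suc M))

partialSums-⊕ : ∀ X Y → partialSums (X ⊕ Y) ≗ partialSums X ⊕ partialSums Y
partialSums-⊕ X Y zero    = refl
partialSums-⊕ X Y (suc M) =
  trans (cong (_+ (X (suc M) + Y (suc M))) (partialSums-⊕ X Y M))
        (+-interchange (partialSums X M) (partialSums Y M) (X (suc M)) (Y (suc M)))

partialSums-⊙ : ∀ c X → partialSums (c ⊙ X) ≗ c ⊙ partialSums X
partialSums-⊙ c X zero    = refl
partialSums-⊙ c X (suc M) =
  trans (cong (_+ c * X (suc M)) (partialSums-⊙ c X M)) (sym (*-distribˡ-+ c _ _))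

partialSums-shift : ∀ X → partialSums (shift X) ≗ shift (partialSums X)
partialSums-shift X zero          = refl
partialSums-shift X (suc zero)    = refl
partialSums-shift X (suc (suc M)) = cong (_+ X (suc M)) (partialSums-shift X (suc M))

shiftBy-cong : ∀ n → Congruent (shiftBy n)
shiftBy-cong = fold-cong shift-cong

shiftBy-⊕ : ∀ n X Y → shiftBy n (X ⊕ Y) ≗ shiftBy n X ⊕ shiftBy n Y
shiftBy-⊕ zero    X Y = λ _ → refl
shiftBy-⊕ (suc n) X Y = ≗-trans (shift-cong (shiftBy-⊕ n X Y)) (shift-⊕ _ _)

shiftBy-+ : ∀ n X M → shiftBy n X (n + M) ≡ X M
shiftBy-+ zero    X M = refl
shiftBy-+ (suc n) X M = shiftBy-+ n X M

shiftBy-< : ∀ n X {M} → M < n → shiftBy n X M ≡ 0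
shiftBy-< (suc n) X {zero}  _         = refl
shiftBy-< (suc n) X {suc M} (s<s M<n) = shiftBy-< n X M<n

-- S and B multiply a series by x + x² and by x³/(1 - x): the contributions
-- of a single part ≤ 2 and of a single part ≥ 3.
S : Series → Series
S X = shift X ⊕ shift (shift X)

B : Series → Series
B X = shiftBy 3 (partialSums X)

S-cong : Congruent S
S-cong p = ⊕-cong (shift-cong p) (shift-cong (shift-cong p))

B-cong : Congruent B
B-cong p = shiftBy-cong 3 (partialSums-cong p)

S-⊙ : ∀ c X → S (c ⊙ X) ≗ c ⊙ S X
S-⊙ c X M = begin
    shift (c ⊙ X) M + shift (shift (c ⊙ X)) M
  ≡⟨ cong₂ _+_ (sym (shift-⊙ c X M))
               (trans (shift-cong (≗-sym (shift-⊙ c X)) M) (sym (shift-⊙ c (shift X) M))) ⟩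
    c * shift X M + c * shift (shift X) M
  ≡⟨ sym (*-distribˡ-+ c _ _) ⟩
    c * S X M ∎
  where open ≡-Reasoning

B-⊙ : ∀ c X → B (c ⊙ X) ≗ c ⊙ B X
B-⊙ c X = ≗-trans (shiftBy-cong 3 (partialSums-⊙ c X))
                  (≗-sym (fold-commute (c ⊙_) shift-cong (shift-⊙ c) 3 (partialSums X)))

B-0ₛ : B 0ₛ ≗ 0ₛ
B-0ₛ = B-⊙ 0 0ₛ

B-S : ∀ X → B (S X) ≗ S (B X)
B-S X = ≗-trans (shiftBy-cong 3 (partialSums-⊕ (shift X) (shift (shift X))))
       (≗-trans (shiftBy-⊕ 3 _ _)
                (⊕-cong (shiftBy-cong 3 (partialSums-shift X))
                        (shiftBy-cong 3 (≗-trans (partialSums-shift (shift X))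
                                                 (shift-cong (partialSums-shift X))))))

conv-cong : ∀ {K L Y Z} → K ≗ L → Y ≗ Z → conv K Y ≗ conv L Z
conv-cong K≗L Y≗Z M = ∑<-cong (suc M) (λ j _ → cong₂ _*_ (K≗L j) (Y≗Z (M ∸ j)))

conv-⊕ˡ : ∀ K L Y → conv (K ⊕ L) Y ≗ conv K Y ⊕ conv L Y
conv-⊕ˡ K L Y M =
  trans (∑<-cong (suc M) (λ j _ → *-distribʳ-+ (Y (M ∸ j)) (K j) (L j)))
        (∑<-+ (suc M) (λ j → K j * Y (M ∸ j)) (λ j → L j * Y (M ∸ j)))

conv-shiftˡ : ∀ K Y → conv (shift K) Y ≗ shift (conv K Y)
conv-shiftˡ K Y zero    = refl
conv-shiftˡ K Y (suc M) = refl

conv-0ₛˡ : ∀ Y → conv 0ₛ Y ≗ 0ₛ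
conv-0ₛˡ Y M = ∑<-zero (suc M) (λ _ _ → refl)

conv-δˡ : ∀ Y → conv δ Y ≗ Y
conv-δˡ Y zero    = trans (+-identityʳ (1 * Y 0)) (*-identityˡ (Y 0))
conv-δˡ Y (suc M) = trans (cong (1 * Y (suc M) +_) (conv-0ₛˡ Y M))
                          (trans (+-identityʳ (1 * Y (suc M))) (*-identityˡ (Y (suc M))))

conv-δʳ : ∀ K → conv K δ ≗ K
conv-δʳ K zero    = trans (+-identityʳ _) (*-identityʳ (K 0))
conv-δʳ K (suc M) = trans (cong (_+ conv (K ∘ suc) δ M) (*-zeroʳ (K 0))) (conv-δʳ (K ∘ suc) M)

conv-1 : ∀ Y → conv (λ _ → 1) Y ≗ partialSums Y
conv-1 Y zero    = trans (+-identityʳ (1 * Y 0)) (*-identityˡ (Y 0))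
conv-1 Y (suc M) = trans (cong₂ _+_ (*-identityˡ (Y (suc M))) (conv-1 Y M)) (+-comm (Y (suc M)) _)

smallKernel : Series
smallKernel 1 = 1
smallKernel 2 = 1
smallKernel _ = 0

bigKernel : Series
bigKernel (suc (suc (suc _))) = 1
bigKernel _ = 0

conv-smallKernel : ∀ Y → conv smallKernel Y ≗ S Y
conv-smallKernel Y zero          = refl
conv-smallKernel Y (suc zero)    = +-identityʳ (1 * Y 0)
conv-smallKernel Y (suc (suc M)) =
  cong₂ _+_ (*-identityˡ (Y (suc M)))
            (trans (conv-cong {Y = Y} {Z = Y} 2+smallKernel≗δ (λ _ → refl) M) (conv-δˡ Y M))
  where
  2+smallKernel≗δ : smallKernel ∘ suc ∘ suc ≗ δ
  2+smallKernel≗δ zero    = refl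
  2+smallKernel≗δ (suc j) = refl

conv-bigKernel : ∀ Y → conv bigKernel Y ≗ B Y
conv-bigKernel Y zero                = refl
conv-bigKernel Y (suc zero)          = refl
conv-bigKernel Y (suc (suc zero))    = refl
conv-bigKernel Y (suc (suc (suc M))) = conv-1 Y M

-- The binomial series (1 + x)ⁿ and (1 - x)⁻ˡ

_C∙ : ℕ → Series
(n C∙) j = n C j

[1+n]C∙≗nC∙⊕shift : ∀ n → (suc n C∙) ≗ (n C∙) ⊕ shift (n C∙)
[1+n]C∙≗nC∙⊕shift n zero    = refl
[1+n]C∙≗nC∙⊕shift n (suc j) = trans (sym (nCk+nC[k+1]≡[n+1]C[k+1] n j)) (+-comm (n C j) _)

0C∙≗δ : (0 C∙) ≗ δ
0C∙≗δ zero    = refl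
0C∙≗δ (suc j) = refl

S^ : ℕ → Series → Series
S^ n X = fold X S n

B^ : ℕ → Series → Series
B^ ℓ X = fold X B ℓ

S^-closedForm : ∀ n Y → S^ n Y ≗ shiftBy n (conv (n C∙) Y)
S^-closedForm zero    Y = ≗-sym (≗-trans (conv-cong 0C∙≗δ (λ _ → refl)) (conv-δˡ Y))
S^-closedForm (suc n) Y = begin
    S (S^ n Y)
  ≈⟨ S-cong (S^-closedForm n Y) ⟩
    shift (shiftBy n Z) ⊕ shift (shift (shiftBy n Z))
  ≈⟨ ⊕-cong (λ _ → refl) (shift-cong (fold-commute shift shift-cong (λ _ _ → refl) n Z)) ⟩
    shift (shiftBy n Z) ⊕ shift (shiftBy n (shift Z))
  ≈⟨ ≗-sym (≗-trans (shift-cong (shiftBy-⊕ n Z (shift Z))) (shift-⊕ _ _)) ⟩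
    shiftBy (suc n) (Z ⊕ shift Z)
  ≈⟨ shiftBy-cong (suc n) (≗-sym (⊕-cong (λ _ → refl) (conv-shiftˡ (n C∙) Y))) ⟩
    shiftBy (suc n) (conv (n C∙) Y ⊕ conv (shift (n C∙)) Y)
  ≈⟨ shiftBy-cong (suc n) (≗-sym (≗-trans (conv-cong ([1+n]C∙≗nC∙⊕shift n) (λ _ → refl))
                                          (conv-⊕ˡ (n C∙) (shift (n C∙)) Y))) ⟩
    shiftBy (suc n) (conv (suc n C∙) Y) ∎
  where
  open import Relation.Binary.Reasoning.Setoid (ℕ →-setoid ℕ)
  Z = conv (n C∙) Y

multichoose : ℕ → Series
multichoose zero    = δ
multichoose (suc k) r = (r + k) C k

partialSums-multichoose : ∀ ℓ → partialSums (multichoose ℓ) ≗ multichoose (suc ℓ)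
partialSums-multichoose zero    zero    = refl
partialSums-multichoose zero    (suc r) = trans (+-identityʳ _) (partialSums-multichoose zero r)
partialSums-multichoose (suc k) zero    = trans (nCn≡1 k) (sym (nCn≡1 (suc k)))
partialSums-multichoose (suc k) (suc r) = begin
    partialSums (multichoose (suc k)) r + suc (r + k) C k
  ≡⟨ cong₂ _+_ (partialSums-multichoose (suc k) r) (cong (_C k) (sym (+-suc r k))) ⟩
    (r + suc k) C suc k + (r + suc k) C k
  ≡⟨ trans (+-comm ((r + suc k) C suc k) _) (nCk+nC[k+1]≡[n+1]C[k+1] (r + suc k) k) ⟩
    suc (r + suc k) C suc k ∎
  where open ≡-Reasoning

B^-δ : ∀ ℓ → B^ ℓ δ ≗ shiftBy (3 * ℓ) (multichoose ℓ)
B^-δ zero    = λ _ → refl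
B^-δ (suc ℓ) M = begin
    B (B^ ℓ δ) M
  ≡⟨ B-cong (B^-δ ℓ) M ⟩
    shiftBy 3 (partialSums (shiftBy (3 * ℓ) (multichoose ℓ))) M
  ≡⟨ shiftBy-cong 3 (≗-trans (fold-commute partialSums shift-cong partialSums-shift (3 * ℓ) _)
                             (shiftBy-cong (3 * ℓ) (partialSums-multichoose ℓ))) M ⟩
    shiftBy (3 + 3 * ℓ) (multichoose (suc ℓ)) M
  ≡⟨ cong (λ n → shiftBy n (multichoose (suc ℓ)) M) (sym (*-suc 3 ℓ)) ⟩
    shiftBy (3 * suc ℓ) (multichoose (suc ℓ)) M ∎
  where open ≡-Reasoning

-- A series in x and y, as the family of its y-coefficients; y· multiplies by y.
y· : (ℕ → Series) → ℕ → Series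
y· F zero    = 0ₛ
y· F (suc ℓ) = F ℓ

-- compSeries h ℓ M is the coefficient of y^ℓ x^M in (x + x² + y x³/(1 - x))^h.
compSeries : ℕ → ℕ → Series
compSeries zero    zero    = δ
compSeries zero    (suc ℓ) = 0ₛ
compSeries (suc h) ℓ       = S (compSeries h ℓ) ⊕ B (y· (compSeries h) ℓ)

-- Counts the compositions whose first n parts are ≤ 2 and whose last ℓ parts
-- are ≥ 3; any other choice of the positions of the big parts gives the same count.
patternSeries : ℕ → ℕ → Series
patternSeries n ℓ = S^ n (B^ ℓ δ)

*-cong-zeroˡ : ∀ {c} m n → c ≡ 0 → c * m ≡ c * n
*-cong-zeroˡ m n refl = refl

compSeries-closedForm : ∀ h ℓ → compSeries h ℓ ≗ (h C ℓ) ⊙ patternSeries (h ∸ ℓ) ℓ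
compSeries-closedForm zero    zero    M = sym (+-identityʳ (δ M))
compSeries-closedForm zero    (suc ℓ) M = refl
compSeries-closedForm (suc h) zero    M = begin
    S (compSeries h 0) M + B 0ₛ M
  ≡⟨ cong₂ _+_ (≗-trans (S-cong (compSeries-closedForm h 0)) (S-⊙ 1 _) M) (B-0ₛ M) ⟩
    1 * S (patternSeries h 0) M + 0
  ≡⟨ +-identityʳ _ ⟩
    1 * patternSeries (suc h) 0 M ∎
  where open ≡-Reasoning
compSeries-closedForm (suc h) (suc ℓ) M = begin
    S (compSeries h (suc ℓ)) M + B (compSeries h ℓ) M
  ≡⟨ cong₂ _+_ (≗-trans (S-cong (compSeries-closedForm h (suc ℓ))) (S-⊙ (h C suc ℓ) _) M)
               (≗-trans (B-cong (compSeries-closedForm h ℓ)) (B-⊙ (h C ℓ) _) M) ⟩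
    (h C suc ℓ) * patternSeries (suc (h ∸ suc ℓ)) (suc ℓ) M + (h C ℓ) * B (patternSeries (h ∸ ℓ) ℓ) M
  ≡⟨ cong₂ _+_ reindex (cong ((h C ℓ) *_) (fold-commute B S-cong B-S (h ∸ ℓ) (B^ ℓ δ) M)) ⟩
    (h C suc ℓ) * P + (h C ℓ) * P
  ≡⟨ sym (*-distribʳ-+ P (h C suc ℓ) (h C ℓ)) ⟩
    (h C suc ℓ + h C ℓ) * P
  ≡⟨ cong (_* P) (trans (+-comm (h C suc ℓ) (h C ℓ)) (nCk+nC[k+1]≡[n+1]C[k+1] h ℓ)) ⟩
    (suc h C suc ℓ) * P ∎
  where
  open ≡-Reasoning
  P = patternSeries (h ∸ ℓ) (suc ℓ) M
  reindex : (h C suc ℓ) * patternSeries (suc (h ∸ suc ℓ)) (suc ℓ) M ≡ (h C suc ℓ) * P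
  reindex with ℓ <? h
  ... | yes ℓ<h = cong (λ n → (h C suc ℓ) * patternSeries n (suc ℓ) M) (sym (+-∸-assoc 1 ℓ<h))
  ... | no  ℓ≮h = *-cong-zeroˡ (patternSeries (suc (h ∸ suc ℓ)) (suc ℓ) M) P hC[1+ℓ]≡0
    where
    hC[1+ℓ]≡0 : h C suc ℓ ≡ 0
    hC[1+ℓ]≡0 = k>n⇒nCk≡0 (s≤s (≮⇒≥ ℓ≮h))

Counted : ∀ {h} → ℕ → ℕ → Pred (Vec ℕ h) 0ℓ
Counted {h} ℓ M v = IsComposition M h v × bigParts v ≡ ℓ

counted? : ∀ {h} ℓ M → Decidable (Counted {h} ℓ M)
counted? {h} ℓ M v = isComposition? M h v ×-dec (bigParts v ≟ ℓ)

countIn : ∀ {h} → List (Vec ℕ h) → ℕ → Series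
countIn xs ℓ M = length (filter (counted? ℓ M) xs)

countComp≡countIn : ∀ m h ℓ → countComp m h ℓ ≡ countIn (tuples h m) ℓ m
countComp≡countIn m h ℓ = cong length (filter-filter (isComposition? m h) (λ v → bigParts v ≟ ℓ) (tuples h m))

part≤weight : ∀ {h ℓ M a} {v : Vec ℕ h} → Counted ℓ M (a ∷ v) → a ≤ M
part≤weight {a = a} ((_ , sum≡M) , _) = subst (a ≤_) sum≡M (m≤m+n a _)

countIn-none : ∀ {h} (xs : List (Vec ℕ h)) {ℓ M a} → (∀ v → ¬ Counted ℓ M (a ∷ v)) →
  countIn (map (a ∷_) xs) ℓ M ≡ 0
countIn-none xs {ℓ} {M} {a} none =
  trans (length-filter-map (counted? ℓ M) (a ∷_) xs) (length-filter-none _ none xs)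

countIn-∷ : ∀ {h} (xs : List (Vec ℕ h)) {ℓ ℓ′ M a} → 1 ≤ a → a ≤ M →
  (∀ {v : Vec ℕ h} → bigParts (a ∷ v) ≡ ℓ → bigParts v ≡ ℓ′) →
  (∀ {v : Vec ℕ h} → bigParts v ≡ ℓ′ → bigParts (a ∷ v) ≡ ℓ) →
  countIn (map (a ∷_) xs) ℓ M ≡ countIn xs ℓ′ (M ∸ a)
countIn-∷ xs {ℓ} {ℓ′} {M} {a} 1≤a a≤M to from =
  trans (length-filter-map (counted? ℓ M) (a ∷_) xs)
        (cong length (filter-≐ (counted? ℓ M ∘ (a ∷_)) (counted? ℓ′ (M ∸ a)) (drop , add) xs))
  where
  drop : ∀ {v} → Counted ℓ M (a ∷ v) → Counted ℓ′ (M ∸ a) v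
  drop {v} ((_ All.∷ positive , sum≡M) , big) =
    (positive , trans (sym (m+n∸m≡n a (sum (toList v)))) (cong (_∸ a) sum≡M)) , to big
  add : ∀ {v} → Counted ℓ′ (M ∸ a) v → Counted ℓ M (a ∷ v)
  add ((positive , sum≡M∸a) , big) =
    (1≤a All.∷ positive , trans (cong (a +_) sum≡M∸a) (m+[n∸m]≡n a≤M)) , from big

countIn-firstPart : ∀ {h} (xs : List (Vec ℕ h)) ℓ {M} a → a ≤ M →
  countIn (map (a ∷_) xs) ℓ M
    ≡ smallKernel a * countIn xs ℓ (M ∸ a) + bigKernel a * y· (countIn xs) ℓ (M ∸ a)
countIn-firstPart xs ℓ zero _ = countIn-none xs λ { v ((() All.∷ _ , _) , _) }
countIn-firstPart xs ℓ 1 a≤M =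
  trans (countIn-∷ xs (s≤s z≤n) a≤M id id) (sym (trans (+-identityʳ _) (+-identityʳ _)))
countIn-firstPart xs ℓ 2 a≤M =
  trans (countIn-∷ xs (s≤s z≤n) a≤M id id) (sym (trans (+-identityʳ _) (+-identityʳ _)))
countIn-firstPart xs zero    (suc (suc (suc _))) _ = countIn-none xs λ { v (_ , ()) }
countIn-firstPart xs (suc ℓ) (suc (suc (suc _))) a≤M =
  trans (countIn-∷ xs (s≤s z≤n) a≤M suc-injective (cong suc)) (sym (+-identityʳ _))

countIn-tuples : ∀ h {B M} ℓ → M ≤ B → countIn (tuples h B) ℓ M ≡ compSeries h ℓ M
countIn-tuples zero {M = zero}  zero    _ = refl
countIn-tuples zero {M = zero}  (suc ℓ) _ = refl
countIn-tuples zero {M = suc M} zero    _ = refl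
countIn-tuples zero {M = suc M} (suc ℓ) _ = refl
countIn-tuples (suc h) {B} {M} ℓ M≤B = begin
    countIn (concatMap (λ a → map (a ∷_) (tuples h B)) (upTo (suc B))) ℓ M
  ≡⟨ length-filter-concatMap (counted? ℓ M) (λ a → map (a ∷_) (tuples h B)) (upTo (suc B)) ⟩
    sum (map (λ a → countIn (map (a ∷_) (tuples h B)) ℓ M) (upTo (suc B)))
  ≡⟨ sum-map-upTo _ (suc B) ⟩
    ∑[ a < suc B ] countIn (map (a ∷_) (tuples h B)) ℓ M
  ≡⟨ ∑<-truncate (suc B) (s≤s M≤B)
       (λ a M<a _ → countIn-none (tuples h B) {ℓ} (λ v counted → <⇒≱ M<a (part≤weight counted))) ⟩
    ∑[ a < suc M ] countIn (map (a ∷_) (tuples h B)) ℓ M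
  ≡⟨ ∑<-cong (suc M) (λ a a≤M → trans (countIn-firstPart (tuples h B) ℓ a (≤-pred a≤M))
                                       (cong₂ _+_ (cong (smallKernel a *_) (IH a ℓ))
                                                  (cong (bigKernel a *_) (y·-IH a ℓ)))) ⟩
    ∑[ a < suc M ] (smallKernel a * compSeries h ℓ (M ∸ a)
                    + bigKernel a * y· (compSeries h) ℓ (M ∸ a))
  ≡⟨ ∑<-+ (suc M) (λ a → smallKernel a * compSeries h ℓ (M ∸ a))
             (λ a → bigKernel a * y· (compSeries h) ℓ (M ∸ a)) ⟩
    conv smallKernel (compSeries h ℓ) M + conv bigKernel (y· (compSeries h) ℓ) M
  ≡⟨ cong₂ _+_ (conv-smallKernel _ M) (conv-bigKernel _ M) ⟩
    compSeries (suc h) ℓ M ∎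
  where
  open ≡-Reasoning
  IH : ∀ a ℓ → countIn (tuples h B) ℓ (M ∸ a) ≡ compSeries h ℓ (M ∸ a)
  IH a ℓ = countIn-tuples h ℓ (≤-trans (m∸n≤m M a) M≤B)
  y·-IH : ∀ a ℓ → y· (countIn (tuples h B)) ℓ (M ∸ a) ≡ y· (compSeries h) ℓ (M ∸ a)
  y·-IH a zero    = refl
  y·-IH a (suc ℓ) = IH a ℓ

countComp≡compSeries : ∀ m h ℓ → countComp m h ℓ ≡ compSeries h ℓ m
countComp≡compSeries m h ℓ = trans (countComp≡countIn m h ℓ) (countIn-tuples h ℓ ≤-refl)

patternSeries-0 : ∀ n K → patternSeries n 0 (n + K) ≡ n C K
patternSeries-0 n K = trans (S^-closedForm n δ (n + K)) (trans (shiftBy-+ n _ K) (conv-δʳ (n C∙) K))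

multichoose-coeff : ∀ k i r K → K ≡ suc k + i + suc k + r →
  shiftBy (3 * suc k) (multichoose (suc k)) (suc k + K ∸ i) ≡ (K ∸ (suc k + i) ∸ 1) C k
multichoose-coeff k i r _ refl = begin
    shiftBy (3 * ℓ) (multichoose ℓ) (ℓ + K ∸ i)
  ≡⟨ cong (shiftBy (3 * ℓ) (multichoose ℓ)) ℓ+K∸i≡3ℓ+r ⟩
    shiftBy (3 * ℓ) (multichoose ℓ) (3 * ℓ + r)
  ≡⟨ shiftBy-+ (3 * ℓ) (multichoose ℓ) r ⟩
    (r + k) C k
  ≡⟨ cong (_C k) (trans (+-comm r k) (cong (_∸ 1) (sym K∸[ℓ+i]≡ℓ+r))) ⟩
    (K ∸ (ℓ + i) ∸ 1) C k ∎
  where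
  open ≡-Reasoning
  ℓ = suc k
  K = ℓ + i + ℓ + r
  ℓ+K∸i≡3ℓ+r : ℓ + K ∸ i ≡ 3 * ℓ + r
  ℓ+K∸i≡3ℓ+r = trans (cong (_∸ i) (rearrange k i r)) (m+n∸n≡m (3 * ℓ + r) i)
    where
    rearrange : ∀ k i r → suc k + (suc k + i + suc k + r) ≡ 3 * suc k + r + i
    rearrange = solve-∀
  K∸[ℓ+i]≡ℓ+r : K ∸ (ℓ + i) ≡ ℓ + r
  K∸[ℓ+i]≡ℓ+r = trans (cong (_∸ (ℓ + i)) (+-assoc (ℓ + i) ℓ r)) (m+n∸m≡n (ℓ + i) (ℓ + r))

patternSeries-coeff : ∀ {h} k K → suc k ≤ h →
  patternSeries (h ∸ suc k) (suc k) (h + K)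
    ≡ ∑[ i < suc (h ⊓ (K ∸ suc k)) ∸ suc k ] (((h ∸ suc k) C i) * ((K ∸ (suc k + i) ∸ 1) C k))
patternSeries-coeff {h} k K ℓ≤h = begin
    patternSeries n ℓ (h + K)
  ≡⟨ cong (patternSeries n ℓ) (trans (cong (_+ K) (sym (m∸n+n≡m ℓ≤h))) (+-assoc n ℓ K)) ⟩
    patternSeries n ℓ (n + (ℓ + K))
  ≡⟨ trans (S^-closedForm n _ (n + (ℓ + K))) (shiftBy-+ n _ (ℓ + K)) ⟩
    conv (n C∙) (B^ ℓ δ) (ℓ + K)
  ≡⟨ conv-cong {K = n C∙} (λ _ → refl) (B^-δ ℓ) (ℓ + K) ⟩
    ∑[ j < suc (ℓ + K) ] ((n C j) * T (ℓ + K ∸ j))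
  ≡⟨ ∑<-truncate (suc (ℓ + K)) c≤1+ℓ+K outside ⟩
    ∑[ j < c ] ((n C j) * T (ℓ + K ∸ j))
  ≡⟨ ∑<-cong c (λ i i<c → cong ((n C i) *_) (inside i (<-range⇒≤ U ℓ i<c))) ⟩
    ∑[ i < c ] ((n C i) * ((K ∸ (ℓ + i) ∸ 1) C k)) ∎
  where
  open ≡-Reasoning
  ℓ = suc k
  n = h ∸ ℓ
  U = h ⊓ (K ∸ ℓ)
  c = suc U ∸ ℓ
  T = shiftBy (3 * ℓ) (multichoose ℓ)
  c≤1+ℓ+K : c ≤ suc (ℓ + K)
  c≤1+ℓ+K = ≤-trans (m∸n≤m (suc U) ℓ)
                    (s≤s (≤-trans (m⊓n≤n h (K ∸ ℓ)) (≤-trans (m∸n≤m K ℓ) (m≤n+m K ℓ))))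
  inside : ∀ i → ℓ + i ≤ U → T (ℓ + K ∸ i) ≡ (K ∸ (ℓ + i) ∸ 1) C k
  inside i ℓ+i≤U = multichoose-coeff k i (K ∸ (ℓ + i + ℓ)) K (sym (m+[n∸m]≡n ℓ+i+ℓ≤K))
    where
    ℓ+i+ℓ≤K : ℓ + i + ℓ ≤ K
    ℓ+i+ℓ≤K = ∸-positive⇒+≤ (m≤n⊓o⇒m≤o h (K ∸ ℓ) ℓ+i≤U)
  outside : ∀ j → c ≤ j → j < suc (ℓ + K) → (n C j) * T (ℓ + K ∸ j) ≡ 0
  outside j c≤j _ with ⊓-sel h (K ∸ ℓ)
  ... | inj₁ U≡h = trans (*-cong-zeroˡ (T (ℓ + K ∸ j)) 0 (k>n⇒nCk≡0 n<j)) (*-zeroʳ (n C j))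
    where
    n<j : n < j
    n<j = subst (n <_) (m+n∸m≡n ℓ j) (∸-monoˡ-< (subst (_< ℓ + j) U≡h (≥-range⇒> U ℓ c≤j)) ℓ≤h)
  ... | inj₂ U≡K∸ℓ = trans (cong ((n C j) *_) (shiftBy-< (3 * ℓ) (multichoose ℓ) ℓ+K∸j<3ℓ)) (*-zeroʳ (n C j))
    where
    K<ℓ+[ℓ+j] : K < ℓ + (ℓ + j)
    K<ℓ+[ℓ+j] = ≤-<-trans (m≤n+m∸n K ℓ) (+-monoʳ-< ℓ (subst (_< ℓ + j) U≡K∸ℓ (≥-range⇒> U ℓ c≤j)))
    rearrange : ∀ k j → suc k + (suc k + (suc k + j)) ≡ j + 3 * suc k
    rearrange = solve-∀
    ℓ+K∸j<3ℓ : ℓ + K ∸ j < 3 * ℓ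
    ℓ+K∸j<3ℓ = m<n+o⇒m∸n<o (ℓ + K) j (subst (ℓ + K <_) (rearrange k j) (+-monoʳ-< ℓ K<ℓ+[ℓ+j]))

sumRange≡∑< : ∀ a b g → sumRange a b g ≡ ∑[ i < suc b ∸ a ] g (a + i)
sumRange≡∑< a b g = sum-map-upTo (λ i → g (a + i)) (suc b ∸ a)

countComp≡c′ : ∀ h m ℓ → h ≤ m → countComp m h ℓ ≡ c′ m h ℓ
countComp≡c′ h m zero h≤m = begin
    countComp m h 0
  ≡⟨ trans (countComp≡compSeries m h 0) (compSeries-closedForm h 0 m) ⟩
    1 * patternSeries h 0 m
  ≡⟨ *-identityˡ _ ⟩
    patternSeries h 0 m
  ≡⟨ cong (patternSeries h 0) (sym (m+[n∸m]≡n h≤m)) ⟩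
    patternSeries h 0 (h + (m ∸ h))
  ≡⟨ patternSeries-0 h (m ∸ h) ⟩
    h C (m ∸ h) ∎
  where open ≡-Reasoning
countComp≡c′ h m (suc k) h≤m with suc k ≤? h
... | no ℓ≰h = trans (trans (countComp≡compSeries m h ℓ) (compSeries-closedForm h ℓ m))
                     (*-cong-zeroˡ (patternSeries (h ∸ ℓ) ℓ m) _ hCℓ≡0)
  where
  ℓ = suc k
  hCℓ≡0 : h C ℓ ≡ 0
  hCℓ≡0 = k>n⇒nCk≡0 (≰⇒> ℓ≰h)
... | yes ℓ≤h = begin
    countComp m h ℓ
  ≡⟨ trans (countComp≡compSeries m h ℓ) (compSeries-closedForm h ℓ m) ⟩
    (h C ℓ) * patternSeries (h ∸ ℓ) ℓ m
  ≡⟨ cong (λ M → (h C ℓ) * patternSeries (h ∸ ℓ) ℓ M) (sym (m+[n∸m]≡n h≤m)) ⟩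
    (h C ℓ) * patternSeries (h ∸ ℓ) ℓ (h + (m ∸ h))
  ≡⟨ cong ((h C ℓ) *_) (patternSeries-coeff k (m ∸ h) ℓ≤h) ⟩
    (h C ℓ) * ∑[ i < c ] (((h ∸ ℓ) C i) * ((m ∸ h ∸ (ℓ + i) ∸ 1) C k))
  ≡⟨ cong ((h C ℓ) *_) (∑<-cong c (λ i _ → cong (λ j → ((h ∸ ℓ) C j) * ((m ∸ h ∸ (ℓ + i) ∸ 1) C k))
                                                  (sym (m+n∸m≡n ℓ i)))) ⟩
    (h C ℓ) * ∑[ i < c ] (((h ∸ ℓ) C (ℓ + i ∸ ℓ)) * ((m ∸ h ∸ (ℓ + i) ∸ 1) C k))
  ≡⟨ cong ((h C ℓ) *_) (sym (sumRange≡∑< ℓ (upperF m h ℓ) G)) ⟩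
    secondForm m h ℓ ∎
  where
  open ≡-Reasoning
  ℓ = suc k
  c = suc (upperF m h ℓ) ∸ ℓ
  G : ℕ → ℕ
  G f = ((h ∸ ℓ) C (f ∸ ℓ)) * ((m ∸ h ∸ f ∸ 1) C (ℓ ∸ 1))

-- The first formula

nCk*[k!*[n∸k]!]≡n! : ∀ {n k} → k ≤ n → (n C k) * (k ! * (n ∸ k) !) ≡ n !
nCk*[k!*[n∸k]!]≡n! {n} {k} k≤n =
  trans (cong (_* (k ! * (n ∸ k) !)) (nCk≡n!/k![n-k]! k≤n))
        (m/n*n≡m {{k !* (n ∸ k) !≢0}} (k![n∸k]!∣n! k≤n))

nCm*mCk≡nCk*[n∸k]C[m∸k] : ∀ {n m k} → k ≤ m → m ≤ n →
  (n C m) * (m C k) ≡ (n C k) * ((n ∸ k) C (m ∸ k))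
nCm*mCk≡nCk*[n∸k]C[m∸k] {n} {m} {k} k≤m m≤n =
  *-cancelʳ-≡ _ _ (k ! * (m ∸ k) ! * (n ∸ m) !) {{m*n≢0 _ _ {{k !* (m ∸ k) !≢0}} {{(n ∸ m) !≢0}}}}
    (trans choose-m-then-k (sym choose-k-then-rest))
  where
  open ≡-Reasoning
  choose-m-then-k : (n C m) * (m C k) * (k ! * (m ∸ k) ! * (n ∸ m) !) ≡ n !
  choose-m-then-k = begin
      (n C m) * (m C k) * (k ! * (m ∸ k) ! * (n ∸ m) !)
    ≡⟨ rearrange (n C m) (m C k) (k !) ((m ∸ k) !) ((n ∸ m) !) ⟩
      (n C m) * ((m C k) * (k ! * (m ∸ k) !) * (n ∸ m) !)
    ≡⟨ cong (λ z → (n C m) * (z * (n ∸ m) !)) (nCk*[k!*[n∸k]!]≡n! k≤m) ⟩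
      (n C m) * (m ! * (n ∸ m) !)
    ≡⟨ nCk*[k!*[n∸k]!]≡n! m≤n ⟩
      n ! ∎
    where
    rearrange : ∀ x y a b c → x * y * (a * b * c) ≡ x * (y * (a * b) * c)
    rearrange = solve-∀
  choose-k-then-rest : (n C k) * ((n ∸ k) C (m ∸ k)) * (k ! * (m ∸ k) ! * (n ∸ m) !) ≡ n !
  choose-k-then-rest = begin
      (n C k) * ((n ∸ k) C (m ∸ k)) * (k ! * (m ∸ k) ! * (n ∸ m) !)
    ≡⟨ rearrange (n C k) ((n ∸ k) C (m ∸ k)) (k !) ((m ∸ k) !) ((n ∸ m) !) ⟩
      (n C k) * (k ! * (((n ∸ k) C (m ∸ k)) * ((m ∸ k) ! * (n ∸ m) !)))
    ≡⟨ cong (λ z → (n C k) * (k ! * (((n ∸ k) C (m ∸ k)) * ((m ∸ k) ! * z !)))) (sym n∸k∸[m∸k]≡n∸m) ⟩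
      (n C k) * (k ! * (((n ∸ k) C (m ∸ k)) * ((m ∸ k) ! * (n ∸ k ∸ (m ∸ k)) !)))
    ≡⟨ cong (λ z → (n C k) * (k ! * z)) (nCk*[k!*[n∸k]!]≡n! (∸-monoˡ-≤ k m≤n)) ⟩
      (n C k) * (k ! * (n ∸ k) !)
    ≡⟨ nCk*[k!*[n∸k]!]≡n! (≤-trans k≤m m≤n) ⟩
      n ! ∎
    where
    rearrange : ∀ x y a b c → x * y * (a * b * c) ≡ x * (a * (y * (b * c)))
    rearrange = solve-∀
    n∸k∸[m∸k]≡n∸m : n ∸ k ∸ (m ∸ k) ≡ n ∸ m
    n∸k∸[m∸k]≡n∸m = trans (∸-+-assoc n k (m ∸ k)) (cong (n ∸_) (m+[n∸m]≡n k≤m))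

[1+k]*[1+n]C[1+k]≡[1+n]*nCk : ∀ {n k} → k ≤ n → suc k * (suc n C suc k) ≡ suc n * (n C k)
[1+k]*[1+n]C[1+k]≡[1+n]*nCk {n} {k} k≤n =
  *-cancelʳ-≡ _ _ (k ! * (n ∸ k) !) {{k !* (n ∸ k) !≢0}}
    (trans (trans (rearrange₁ (suc k) (suc n C suc k) (k !) ((n ∸ k) !)) (nCk*[k!*[n∸k]!]≡n! (s≤s k≤n)))
           (sym (trans (rearrange₂ (suc n) (n C k) (k !) ((n ∸ k) !)) (cong (suc n *_) (nCk*[k!*[n∸k]!]≡n! k≤n)))))
  where
  rearrange₁ : ∀ s x a b → s * x * (a * b) ≡ x * (s * a * b)
  rearrange₁ = solve-∀
  rearrange₂ : ∀ s y a b → s * y * (a * b) ≡ s * (y * (a * b))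
  rearrange₂ = solve-∀

fromℚᵘ-homo-+ : ∀ p q → fromℚᵘ p +ℚ fromℚᵘ q ≡ fromℚᵘ (p +ᵘ q)
fromℚᵘ-homo-+ p q = toℚᵘ-injective
  (ℚᵘ.≃-trans (toℚᵘ-homo-+ (fromℚᵘ p) (fromℚᵘ q))
  (ℚᵘ.≃-trans (ℚᵘ.+-cong (toℚᵘ-fromℚᵘ p) (toℚᵘ-fromℚᵘ q)) (ℚᵘ.≃-sym (toℚᵘ-fromℚᵘ (p +ᵘ q)))))

fromℚᵘ-homo-* : ∀ p q → fromℚᵘ p *ℚ fromℚᵘ q ≡ fromℚᵘ (p *ᵘ q)
fromℚᵘ-homo-* p q = toℚᵘ-injective
  (ℚᵘ.≃-trans (toℚᵘ-homo-* (fromℚᵘ p) (fromℚᵘ q))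
  (ℚᵘ.≃-trans (ℚᵘ.*-cong (toℚᵘ-fromℚᵘ p) (toℚᵘ-fromℚᵘ q)) (ℚᵘ.≃-sym (toℚᵘ-fromℚᵘ (p *ᵘ q)))))

ℕtoℚ-+ : ∀ a b → ℕtoℚ (a + b) ≡ ℕtoℚ a +ℚ ℕtoℚ b
ℕtoℚ-+ a b = sym (trans (fromℚᵘ-homo-+ (mkℚᵘ (ℤ.+ a) 0) (mkℚᵘ (ℤ.+ b) 0))
  (fromℚᵘ-cong {mkℚᵘ (ℤ.+ a) 0 +ᵘ mkℚᵘ (ℤ.+ b) 0} {mkℚᵘ (ℤ.+ (a + b)) 0} (*≡* cross)))
  where
  cross : (ℤ.+ a ℤ.* ℤ.+ 1 ℤ.+ ℤ.+ b ℤ.* ℤ.+ 1) ℤ.* ℤ.+ 1 ≡ ℤ.+ (a + b) ℤ.* ℤ.+ 1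
  cross = cong (ℤ._* ℤ.+ 1) (trans (cong₂ ℤ._+_ (ℤ.*-identityʳ (ℤ.+ a)) (ℤ.*-identityʳ (ℤ.+ b)))
                                   (sym (ℤ.pos-+ a b)))

fracℚ*ℕtoℚ : ∀ a d N K → a * N ≡ suc d * K → fracℚ a (suc d) *ℚ ℕtoℚ N ≡ ℕtoℚ K
fracℚ*ℕtoℚ a d N K aN≡[1+d]K =
  trans (fromℚᵘ-homo-* (mkℚᵘ (ℤ.+ a) d) (mkℚᵘ (ℤ.+ N) 0))
        (fromℚᵘ-cong {mkℚᵘ (ℤ.+ a) d *ᵘ mkℚᵘ (ℤ.+ N) 0} {mkℚᵘ (ℤ.+ K) 0} (*≡* cross))
  where
  cross : (ℤ.+ a ℤ.* ℤ.+ N) ℤ.* ℤ.+ 1 ≡ ℤ.+ K ℤ.* ℤ.+ suc (d * 1)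
  cross = trans (ℤ.*-identityʳ _) (trans (sym (ℤ.pos-* a N))
            (trans (cong ℤ.+_ (trans aN≡[1+d]K (trans (*-comm (suc d) K)
                                                        (cong (λ z → K * suc z) (sym (*-identityʳ d))))))
                   (ℤ.pos-* K (suc (d * 1)))))

∑ℚ< : ℕ → (ℕ → ℚ) → ℚ
∑ℚ< n F = foldr _+ℚ_ 0ℚ (applyUpTo F n)

∑ℚ<-cong : ∀ n {F G : ℕ → ℚ} → (∀ i → i < n → F i ≡ G i) → ∑ℚ< n F ≡ ∑ℚ< n G
∑ℚ<-cong zero    eq = refl
∑ℚ<-cong (suc n) eq = cong₂ _+ℚ_ (eq 0 z<s) (∑ℚ<-cong n (λ i i<n → eq (suc i) (s<s i<n)))

ℕtoℚ-∑< : ∀ n F → ℕtoℚ (∑< n F) ≡ ∑ℚ< n (ℕtoℚ ∘ F)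
ℕtoℚ-∑< zero    F = refl
ℕtoℚ-∑< (suc n) F = trans (ℕtoℚ-+ (F 0) _) (cong (ℕtoℚ (F 0) +ℚ_) (ℕtoℚ-∑< n (F ∘ suc)))

firstForm-term : ∀ {h f d} k → suc k ≤ f → f ≤ h → suc k ≤ d →
  fracℚ (suc k) d *ℚ ℕtoℚ ((h C f) * (f C suc k) * (d C suc k))
    ≡ ℕtoℚ ((h C suc k) * (((h ∸ suc k) C (f ∸ suc k)) * ((d ∸ 1) C k)))
firstForm-term {h} {f} {suc d} k ℓ≤f f≤h (s≤s k≤d) = fracℚ*ℕtoℚ ℓ d _ _ (begin
    ℓ * ((h C f) * (f C ℓ) * (suc d C ℓ))
  ≡⟨ rearrange₁ ℓ (h C f) (f C ℓ) (suc d C ℓ) ⟩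
    (h C f) * (f C ℓ) * (ℓ * (suc d C ℓ))
  ≡⟨ cong₂ _*_ (nCm*mCk≡nCk*[n∸k]C[m∸k] ℓ≤f f≤h) ([1+k]*[1+n]C[1+k]≡[1+n]*nCk k≤d) ⟩
    (h C ℓ) * ((h ∸ ℓ) C (f ∸ ℓ)) * (suc d * (d C k))
  ≡⟨ rearrange₂ (h C ℓ) ((h ∸ ℓ) C (f ∸ ℓ)) (suc d) (d C k) ⟩
    suc d * ((h C ℓ) * (((h ∸ ℓ) C (f ∸ ℓ)) * (d C k))) ∎)
  where
  open ≡-Reasoning
  ℓ = suc k
  rearrange₁ : ∀ l x y z → l * (x * y * z) ≡ x * y * (l * z)
  rearrange₁ = solve-∀
  rearrange₂ : ∀ x y s z → x * y * (s * z) ≡ s * (x * (y * z))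
  rearrange₂ = solve-∀

secondForm≡firstForm : ∀ m h k → ℕtoℚ (secondForm m h (suc k)) ≡ firstForm m h (suc k)
secondForm≡firstForm m h k = begin
    ℕtoℚ ((h C ℓ) * sumRange ℓ U G)
  ≡⟨ cong (λ z → ℕtoℚ ((h C ℓ) * z)) (sumRange≡∑< ℓ U G) ⟩
    ℕtoℚ ((h C ℓ) * ∑[ i < c ] G (ℓ + i))
  ≡⟨ cong ℕtoℚ (sym (∑<-*ˡ c (h C ℓ) (G ∘ (ℓ +_)))) ⟩
    ℕtoℚ (∑[ i < c ] ((h C ℓ) * G (ℓ + i)))
  ≡⟨ ℕtoℚ-∑< c (λ i → (h C ℓ) * G (ℓ + i)) ⟩
    ∑ℚ< c (λ i → ℕtoℚ ((h C ℓ) * G (ℓ + i)))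
  ≡⟨ ∑ℚ<-cong c (λ i i<c → sym (term i (<-range⇒≤ U ℓ i<c))) ⟩
    ∑ℚ< c (λ i → F (ℓ + i))
  ≡⟨ cong (foldr _+ℚ_ 0ℚ) (sym (map-applyUpTo id (F ∘ (ℓ +_)) c)) ⟩
    firstForm m h ℓ ∎
  where
  open ≡-Reasoning
  ℓ = suc k
  U = upperF m h ℓ
  c = suc U ∸ ℓ
  G : ℕ → ℕ
  G f = ((h ∸ ℓ) C (f ∸ ℓ)) * ((m ∸ h ∸ f ∸ 1) C (ℓ ∸ 1))
  F : ℕ → ℚ
  F f = fracℚ ℓ (m ∸ h ∸ f) *ℚ ℕtoℚ ((h C f) * (f C ℓ) * ((m ∸ h ∸ f) C ℓ))
  term : ∀ i → ℓ + i ≤ U → F (ℓ + i) ≡ ℕtoℚ ((h C ℓ) * G (ℓ + i))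
  term i ℓ+i≤U = firstForm-term k (m≤m+n ℓ i) (m≤n⊓o⇒m≤n h (m ∸ h ∸ ℓ) ℓ+i≤U) ℓ≤m∸h∸[ℓ+i]
    where
    ℓ≤m∸h∸[ℓ+i] : ℓ ≤ m ∸ h ∸ (ℓ + i)
    ℓ≤m∸h∸[ℓ+i] = m+n≤o⇒m≤o∸n ℓ (subst (_≤ m ∸ h) (+-comm (ℓ + i) ℓ)
                    (∸-positive⇒+≤ (m≤n⊓o⇒m≤o h (m ∸ h ∸ ℓ) ℓ+i≤U)))

mainTheorem10 : (h m ℓ : ℕ) → 1 ≤ h → h ≤ m →
    countComp m h ℓ ≡ c′ m h ℓ
    × (1 ≤ ℓ → ℕtoℚ (c′ m h ℓ) ≡ firstForm m h ℓ × c′ m h ℓ ≡ secondForm m h ℓ)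
mainTheorem10 h m ℓ _ h≤m = countComp≡c′ h m ℓ h≤m , formulas ℓ
  where
  formulas : ∀ ℓ → 1 ≤ ℓ → ℕtoℚ (c′ m h ℓ) ≡ firstForm m h ℓ × c′ m h ℓ ≡ secondForm m h ℓ
  formulas (suc k) _ = secondForm≡firstForm m h k , refl
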